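{- For any $r$-regular graph $G$ of order $n$ and every integer $k$ with $1-\lceil r/2\rceil\le k\le\lfloor r/2\rfloor$, $\mathcal{M}_k(G)\ge\left\lceil\frac{n(2k+r)}{2r}\right\rceil$.
   Context: All graphs are finite and simple. For a vertex $v$, $\delta(v)$ is its degree and $\delta_X(v)=|N(v)\cap X|$. For an integer $k$ with $1-\lceil\delta(G)/2\rceil\le k\le\lfloor\delta(G)/2\rfloor$ ($\delta(G)$ the minimum degree), a nonempty set $M\subseteq V(G)$ is a $k$-monopoly if every vertex $v$ satisfies $\delta_M(v)\ge\frac{\delta(v)}{2}+k$; $\mathcal{M}_k(G)$ is the minimum cardinality of a $k$-monopoly. -}

module Defs where

open import Data.Nat using (ℕ; suc; NonZero)
open import Data.Bool using (Bool; true; false; _∧_)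
open import Data.Fin using (Fin)
open import Data.Fin.Subset using (Subset; Nonempty)
open import Data.Vec using (Vec; lookup; allFin; countᵇ)
open import Data.Integer as ℤ using (ℤ; +_)
open import Data.Rational as ℚ using (ℚ; _/_; _≤_)
open import Relation.Binary.PropositionalEquality using (_≡_)
open import Data.Product using (_×_)
open import Relation.Nullary using (¬_)

record Graph (n : ℕ) : Set where
  field
    adj   : Fin n → Fin n → Bool
    sym   : ∀ u v → adj u v ≡ adj v u
    irrefl : ∀ v → adj v v ≡ false
open Graph public

deg : ∀ {n} → Graph n → Fin n → ℕ
deg {n} G v = countᵇ (adj G v) (allFin n)

degIn : ∀ {n} → Graph n → Subset n → Fin n → ℕ
degIn {n} G X v = countᵇ (λ u → adj G v u ∧ lookup X u) (allFin n)

Regular : ∀ {n} → Graph n → ℕ → Set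
Regular G r = ∀ v → deg G v ≡ r

IsMonopoly : ∀ {n} → Graph n → ℤ → Subset n → Set
IsMonopoly {n} G k M =
  Nonempty M × (∀ (v : Fin n) → (+ deg G v) / 2 ℚ.+ (k / 1) ≤ (+ degIn G M v) / 1)

-- Double counting the adjacent pairs (v, u) with u ∈ M gives
-- Σ_v δ_M(v) = Σ_{u ∈ M} δ(u) = r∣M∣ in an r-regular graph.  The monopoly
-- condition bounds each summand below by r/2 + k, whence n(r/2 + k) ≤ r∣M∣,
-- and ∣M∣, being an integer, is at least the ceiling of n(2k + r)/(2r).
module Submission where

open import Defs
open import Data.Nat using (ℕ; NonZero; _*_; ⌈_/2⌉; ⌊_/2⌋)
open import Data.Nat.Properties using (m*n≢0)
open import Data.Fin.Subset using (Subset; ∣_∣)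
open import Data.Integer as ℤ using (ℤ; +_; _-_; _≤_)
open import Data.Rational as ℚ using (_/_; ceiling)

open import Data.Bool using (Bool; true; false; _∧_)
open import Data.Fin using (Fin; zero; suc)
open import Data.Vec using ([]; _∷_; lookup; tabulate; countᵇ)
open import Data.Product using (_,_)
open import Function using (_∘_; id)
open import Relation.Binary.PropositionalEquality as ≡
  using (_≡_; refl; cong; subst; subst₂; module ≡-Reasoning)
import Data.Nat as ℕ
import Data.Nat.Properties as ℕ
open import Algebra.Properties.Semiring.Sum ℕ.+-*-semiring
  using (sum-syntax; sum-cong-≗; ∑-comm; *-distribˡ-sum; *-distribʳ-sum)
open import Data.Integer using (_<_)
import Data.Integer.Properties as ℤ
open import Data.Integer.DivMod using (div-pos-is-/ℕ; n<s[n/ℕd]*d)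
open import Data.Integer.Tactic.RingSolver using (solve-∀)
open import Data.Rational using (ℚ; mkℚ; ↥_; ↧_; floor)
import Data.Rational.Properties as ℚ
open import Data.Rational.Unnormalised as ℚᵘ using (mkℚᵘ; *≡*; *≤*)
import Data.Rational.Unnormalised.Properties as ℚᵘ

toℕ : Bool → ℕ
toℕ true  = 1
toℕ false = 0

toℕ-∧ : ∀ a b → toℕ (a ∧ b) ≡ toℕ a * toℕ b
toℕ-∧ true  b = ≡.sym (ℕ.+-identityʳ (toℕ b))
toℕ-∧ false b = refl

countᵇ-tabulate : ∀ {a} {A : Set a} {n} (P : A → Bool) (f : Fin n → A) →
                  countᵇ P (tabulate f) ≡ ∑[ i < n ] toℕ (P (f i))
countᵇ-tabulate {n = ℕ.zero}  P f = refl
countᵇ-tabulate {n = ℕ.suc n} P f with P (f zero)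
... | true  = cong ℕ.suc (countᵇ-tabulate P (f ∘ suc))
... | false = countᵇ-tabulate P (f ∘ suc)

∣p∣≡∑ : ∀ {n} (p : Subset n) → ∣ p ∣ ≡ ∑[ i < n ] toℕ (lookup p i)
∣p∣≡∑ []          = refl
∣p∣≡∑ (true  ∷ p) = cong ℕ.suc (∣p∣≡∑ p)
∣p∣≡∑ (false ∷ p) = ∣p∣≡∑ p

∑-degIn≡∑-deg : ∀ {n} (G : Graph n) (M : Subset n) →
                ∑[ v < n ] degIn G M v ≡ ∑[ u < n ] (deg G u * toℕ (lookup M u))
∑-degIn≡∑-deg {n} G M = begin
  ∑[ v < n ] degIn G M v
    ≡⟨ sum-cong-≗ (λ v → countᵇ-tabulate (λ u → adj G v u ∧ lookup M u) id) ⟩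
  ∑[ v < n ] ∑[ u < n ] toℕ (adj G v u ∧ lookup M u)
    ≡⟨ ∑-comm (λ v u → toℕ (adj G v u ∧ lookup M u)) ⟩
  ∑[ u < n ] ∑[ v < n ] toℕ (adj G v u ∧ lookup M u)
    ≡⟨ sum-cong-≗ (λ u → sum-cong-≗ (λ v → edge u v)) ⟩
  ∑[ u < n ] ∑[ v < n ] (toℕ (adj G u v) * toℕ (lookup M u))
    ≡⟨ sum-cong-≗ (λ u → ≡.sym (*-distribʳ-sum (toℕ (lookup M u)) (toℕ ∘ adj G u))) ⟩
  ∑[ u < n ] (∑[ v < n ] toℕ (adj G u v) * toℕ (lookup M u))
    ≡⟨ sum-cong-≗ (λ u → cong (_* toℕ (lookup M u)) (≡.sym (countᵇ-tabulate (adj G u) id))) ⟩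
  ∑[ u < n ] (deg G u * toℕ (lookup M u)) ∎
  where
  open ≡-Reasoning
  edge : ∀ u v → toℕ (adj G v u ∧ lookup M u) ≡ toℕ (adj G u v) * toℕ (lookup M u)
  edge u v = ≡.trans (toℕ-∧ (adj G v u) (lookup M u))
                   (cong (λ b → toℕ b * toℕ (lookup M u)) (Graph.sym G v u))

∑-degIn-regular : ∀ {n r} (G : Graph n) → Regular G r → (M : Subset n) →
                  ∑[ v < n ] degIn G M v ≡ r * ∣ M ∣
∑-degIn-regular {n} {r} G reg M = begin
  ∑[ v < n ] degIn G M v                   ≡⟨ ∑-degIn≡∑-deg G M ⟩
  ∑[ u < n ] (deg G u * toℕ (lookup M u))  ≡⟨ sum-cong-≗ (λ u → cong (_* toℕ (lookup M u)) (reg u)) ⟩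
  ∑[ u < n ] (r * toℕ (lookup M u))        ≡⟨ *-distribˡ-sum r (toℕ ∘ lookup M) ⟨
  r * ∑[ u < n ] toℕ (lookup M u)          ≡⟨ cong (r *_) (∣p∣≡∑ M) ⟨
  r * ∣ M ∣                                ∎
  where open ≡-Reasoning

n*c≤∑ : ∀ {n} (c : ℤ) (f : Fin n → ℕ) → (∀ i → c ≤ + f i) → + n ℤ.* c ≤ + ∑[ i < n ] f i
n*c≤∑ {ℕ.zero}  c f c≤f = ℤ.≤-reflexive (ℤ.*-zeroˡ c)
n*c≤∑ {ℕ.suc n} c f c≤f = begin
  + ℕ.suc n ℤ.* c                       ≡⟨ ℤ.suc-* (+ n) c ⟩
  c ℤ.+ + n ℤ.* c                       ≤⟨ ℤ.+-mono-≤ (c≤f zero) (n*c≤∑ c (f ∘ suc) (c≤f ∘ suc)) ⟩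
  + f zero ℤ.+ + ∑[ i < n ] f (suc i)   ≡⟨ ℤ.pos-+ (f zero) _ ⟨
  + ∑[ i < ℕ.suc n ] f i                ∎
  where open ℤ.≤-Reasoning

floor-≥ : (p : ℚ) (i : ℤ) → i ℤ.* ↧ p ≤ ↥ p → i ≤ floor p
floor-≥ p@(mkℚ j d-1 _) i i*d≤j =
  subst (i ≤_) (ℤ.pred-suc (floor p)) (ℤ.i<j⇒i≤pred[j] i<suc⌊p⌋)
  where
  d = ↧ p
  i*d<suc⌊p⌋*d : i ℤ.* d < ℤ.suc (floor p) ℤ.* d
  i*d<suc⌊p⌋*d = ℤ.≤-<-trans i*d≤j
    (subst (λ q → j < ℤ.suc q ℤ.* d) (≡.sym (div-pos-is-/ℕ j (ℕ.suc d-1))) (n<s[n/ℕd]*d j (ℕ.suc d-1)))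
  i<suc⌊p⌋ : i < ℤ.suc (floor p)
  i<suc⌊p⌋ = ℤ.*-cancelʳ-<-nonNeg d i*d<suc⌊p⌋*d

ceiling-≤ : (p : ℚ) (i : ℤ) → ↥ p ≤ i ℤ.* ↧ p → ceiling p ≤ i
ceiling-≤ p@(mkℚ _ _ _) i ↥p≤i*↧p =
  subst (ceiling p ≤_) (ℤ.neg-involutive i) (ℤ.neg-mono-≤ (floor-≥ (ℚ.- p) (ℤ.- i) -i*↧[-p]≤↥[-p]))
  where
  -i*↧[-p]≤↥[-p] : ℤ.- i ℤ.* ↧ (ℚ.- p) ≤ ↥ (ℚ.- p)
  -i*↧[-p]≤↥[-p] = subst₂ _≤_
    (≡.trans (ℤ.neg-distribˡ-* i (↧ p)) (cong (ℤ.- i ℤ.*_) (≡.sym (ℚ.↧-neg p))))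
    (≡.sym (ℚ.↥-neg p))
    (ℤ.neg-mono-≤ ↥p≤i*↧p)

ceiling-/-≤ : ∀ (i : ℤ) d .{{_ : NonZero d}} (m : ℤ) → i ≤ m ℤ.* + d → ceiling (i / d) ≤ m
ceiling-/-≤ i d@(ℕ.suc d-1) m i≤m*d = ceiling-≤ p m (ℤ.*-cancelʳ-≤-pos (↥ p) (m ℤ.* ↧ p) (+ d) ↥p*d≤m*↧p*d)
  where
  p = i / d
  ↥p*d≡i*↧p : ↥ p ℤ.* + d ≡ i ℤ.* ↧ p
  ↥p*d≡i*↧p with ℚ.toℚᵘ-fromℚᵘ (mkℚᵘ i d-1)
  ... | *≡* eq = subst₂ (λ x y → x ℤ.* + d ≡ i ℤ.* y) (ℚ.↥ᵘ-toℚᵘ p) (ℚ.↧ᵘ-toℚᵘ p) eq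
  ↥p*d≤m*↧p*d : ↥ p ℤ.* + d ≤ m ℤ.* ↧ p ℤ.* + d
  ↥p*d≤m*↧p*d = begin
    ↥ p ℤ.* + d          ≡⟨ ↥p*d≡i*↧p ⟩
    i ℤ.* ↧ p            ≤⟨ ℤ.*-monoʳ-≤-nonNeg (↧ p) i≤m*d ⟩
    m ℤ.* + d ℤ.* ↧ p    ≡⟨ ℤ.*-assoc m (+ d) (↧ p) ⟩
    m ℤ.* (+ d ℤ.* ↧ p)  ≡⟨ cong (m ℤ.*_) (ℤ.*-comm (+ d) (↧ p)) ⟩
    m ℤ.* (↧ p ℤ.* + d)  ≡⟨ ℤ.*-assoc m (↧ p) (+ d) ⟨
    m ℤ.* ↧ p ℤ.* + d    ∎
    where open ℤ.≤-Reasoning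

x/2+y≤z⇒2y+x≤2z : ∀ (x y z : ℤ) → x / 2 ℚ.+ y / 1 ℚ.≤ z / 1 → + 2 ℤ.* y ℤ.+ x ≤ + 2 ℤ.* z
x/2+y≤z⇒2y+x≤2z x y z x/2+y≤z with unnormalised
  where
  unnormalised : mkℚᵘ x 1 ℚᵘ.+ mkℚᵘ y 0 ℚᵘ.≤ mkℚᵘ z 0
  unnormalised = ℚᵘ.≤-respʳ-≃ (ℚ.toℚᵘ-fromℚᵘ (mkℚᵘ z 0))
    (ℚᵘ.≤-respˡ-≃ (ℚᵘ.≃-trans (ℚ.toℚᵘ-homo-+ (x / 2) (y / 1))
                              (ℚᵘ.+-cong (ℚ.toℚᵘ-fromℚᵘ (mkℚᵘ x 1)) (ℚ.toℚᵘ-fromℚᵘ (mkℚᵘ y 0))))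
      (ℚ.toℚᵘ-mono-≤ x/2+y≤z))
... | *≤* cross = subst₂ _≤_ (lhs x y) (ℤ.*-comm z (+ 2)) cross
  where
  lhs : ∀ a b → (a ℤ.* + 1 ℤ.+ b ℤ.* + 2) ℤ.* + 1 ≡ + 2 ℤ.* b ℤ.+ a
  lhs = solve-∀

monopoly-degIn-≥ : ∀ {n} (G : Graph n) (k : ℤ) (M : Subset n) → IsMonopoly G k M →
                   ∀ v → + 2 ℤ.* k ℤ.+ + deg G v ≤ + (2 * degIn G M v)
monopoly-degIn-≥ G k M (_ , monopoly) v =
  subst (_ ≤_) (≡.sym (ℤ.pos-* 2 (degIn G M v)))
    (x/2+y≤z⇒2y+x≤2z (+ deg G v) k (+ degIn G M v) (monopoly v))

theorem10 : ∀ {n r : ℕ} .{{_ : NonZero r}} (G : Graph n) → Regular G r →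
    (k : ℤ) → (+ 1) - (+ ⌈ r /2⌉) ≤ k → k ≤ + ⌊ r /2⌋ →
    (M : Subset n) → IsMonopoly G k M →
    ceiling (_/_ ((+ n) ℤ.* ((+ 2) ℤ.* k ℤ.+ (+ r))) (2 * r) {{m*n≢0 2 r}}) ≤ + ∣ M ∣
-- The range of k only guarantees that k-monopolies can exist; the bound holds without it.
theorem10 {n} {r} G regular k _ _ M monopoly =
  ceiling-/-≤ _ (2 * r) {{m*n≢0 2 r}} (+ ∣ M ∣) n[2k+r]≤∣M∣*2r
  where
  2k+r≤2δM : ∀ v → + 2 ℤ.* k ℤ.+ + r ≤ + (2 * degIn G M v)
  2k+r≤2δM v = subst (λ d → + 2 ℤ.* k ℤ.+ + d ≤ _) (regular v) (monopoly-degIn-≥ G k M monopoly v)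

  ∑2δM≡∣M∣*2r : ∑[ v < n ] (2 * degIn G M v) ≡ ∣ M ∣ * (2 * r)
  ∑2δM≡∣M∣*2r = let open ≡-Reasoning in begin
    ∑[ v < n ] (2 * degIn G M v)  ≡⟨ *-distribˡ-sum 2 (degIn G M) ⟨
    2 * ∑[ v < n ] degIn G M v    ≡⟨ cong (2 *_) (∑-degIn-regular G regular M) ⟩
    2 * (r * ∣ M ∣)               ≡⟨ ℕ.*-assoc 2 r ∣ M ∣ ⟨
    2 * r * ∣ M ∣                 ≡⟨ ℕ.*-comm (2 * r) ∣ M ∣ ⟩
    ∣ M ∣ * (2 * r)               ∎

  n[2k+r]≤∣M∣*2r : + n ℤ.* (+ 2 ℤ.* k ℤ.+ + r) ≤ + ∣ M ∣ ℤ.* + (2 * r)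
  n[2k+r]≤∣M∣*2r = let open ℤ.≤-Reasoning in begin
    + n ℤ.* (+ 2 ℤ.* k ℤ.+ + r)     ≤⟨ n*c≤∑ _ (λ v → 2 * degIn G M v) 2k+r≤2δM ⟩
    + ∑[ v < n ] (2 * degIn G M v)  ≡⟨ cong +_ ∑2δM≡∣M∣*2r ⟩
    + (∣ M ∣ * (2 * r))             ≡⟨ ℤ.pos-* ∣ M ∣ (2 * r) ⟩
    + ∣ M ∣ ℤ.* + (2 * r)           ∎
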